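{- Let $\lambda$ be a partition with distinct parts, with $o$ odd parts, $e$ even parts and length $\ell(\lambda)$, and let $k=\max(o,\,e+(\ell(\lambda)\bmod 2))$. Then $Q_\lambda(1^t)=Q_\lambda(\underbrace{1,\dots,1}_{t})$, regarded as a polynomial in $t$, is divisible by $t^{k}$.
   Context: Define $q_k$ by $\sum_{k\ge 0} q_k u^k=\prod_i \frac{1+x_i u}{1-x_i u}$, and $q_k=0$ for $k<0$. Schur's $Q$-functions: $Q_{(a)}=q_a$, $Q_{(a,b)}=q_aq_b+2\sum_{m>0}(-1)^m q_{a+m}q_{b-m}$, and inductively $Q_{(\lambda_1,\dots,\lambda_{2k+1})}=\sum_{i=1}^{2k+1}(-1)^{i+1}q_{\lambda_i}Q_{(\lambda_1,\dots,\widehat{\lambda_i},\dots,\lambda_{2k+1})}$, $Q_{(\lambda_1,\dots,\lambda_{2k})}=\sum_{i=2}^{2k}(-1)^{i}Q_{(\lambda_1,\lambda_i)}Q_{(\lambda_2,\dots,\widehat{\lambda_i},\dots,\lambda_{2k})}$. $Q_\lambda(1^t)$ is the specialization $x_1=\dots=x_t=1$, $x_j=0$ for $j>t$; it is a polynomial in $t$ since $p_\nu(1^t)=t^{\ell(\nu)}$. For an integer $a$, $a\bmod 2$ is $1$ if $a$ is odd and $0$ otherwise. (The number $k$ is the minimal number of bars in a bar tableau of shifted shape $\lambda$.) -}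

module Defs where

open import Data.Nat as ℕ using (ℕ; zero; suc; _<_; _⊔_)
open import Data.Nat.DivMod using (_%_)
open import Data.Integer as ℤ using (ℤ; +_)
open import Data.Rational as ℚ using (ℚ)
open import Data.List using (List; []; _∷_; length)
open import Data.Product using (_×_; _,_)
open import Data.Bool using (Bool; true; false; if_then_else_; not)

isEven : ℕ → Bool
isEven zero = true
isEven (suc n) = not (isEven n)

-- q_k(1^t): coefficient of u^k in ((1+u)/(1-u))^t, computed by
-- ((1+u)/(1-u))^(t+1) = (1 + 2u + 2u^2 + ...) ((1+u)/(1-u))^t.
sumBelow : (ℕ → ℕ) → ℕ → ℕ
sumBelow f zero    = 0
sumBelow f (suc k) = sumBelow f k ℕ.+ f k

qnat : ℕ → ℕ → ℕ
qnat zero    zero    = 1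
qnat zero    (suc k) = 0
qnat (suc t) k       = qnat t k ℕ.+ 2 ℕ.* sumBelow (qnat t) k

q : ℕ → ℕ → ℤ
q t k = + qnat t k

sign : ℕ → ℤ
sign zero    = + 1
sign (suc m) = ℤ.- sign m

pairSum : ℕ → ℕ → ℕ → ℕ → ℤ
-- pairSum t a b m = Σ_{j=m}^{b} (-1)^j q_{a+j} q_{b-j}  (by fuel on b ∸ m)
pairSum t a b m = go (b ℕ.∸ m) m
  where
  go : ℕ → ℕ → ℤ
  go zero    j = sign j ℤ.* (q t (a ℕ.+ j) ℤ.* q t (b ℕ.∸ j))
  go (suc n) j = sign j ℤ.* (q t (a ℕ.+ j) ℤ.* q t (b ℕ.∸ j)) ℤ.+ go n (suc j)

-- Q_{(a,b)}(1^t) = q_a q_b + 2 Σ_{m>0} (-1)^m q_{a+m} q_{b-m}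
Qpair : ℕ → ℕ → ℕ → ℤ
Qpair t a zero    = q t a ℤ.* q t 0
Qpair t a (suc b) = q t a ℤ.* q t (suc b) ℤ.+ (+ 2) ℤ.* pairSum t a (suc b) 1

picks : {A : Set} → List A → List (A × List A)
picks []       = []
picks (x ∷ xs) = (x , xs) ∷ mapRest x (picks xs)
  where
  mapRest : {A : Set} → A → List (A × List A) → List (A × List A)
  mapRest x []              = []
  mapRest x ((y , ys) ∷ r)  = (y , x ∷ ys) ∷ mapRest x r

altSum : {A : Set} → (A → ℤ) → List A → ℤ
altSum f = go 0
  where
  go : ℕ → _ → ℤ
  go i []       = + 0
  go i (x ∷ xs) = sign i ℤ.* f x ℤ.+ go (suc i) xs

-- Pfaffian recursion, with fuel (fuel ≥ length suffices)
Qfuel : ℕ → ℕ → List ℕ → ℤ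
Qfuel t zero    _  = + 1
Qfuel t (suc n) [] = + 1
Qfuel t (suc n) (x ∷ xs) with isEven (length (x ∷ xs))
... | true =
  altSum (λ { (y , ys) → Qpair t x y ℤ.* Qfuel t n ys }) (picks xs)
... | false =
  altSum (λ { (y , ys) → q t y ℤ.* Qfuel t n ys }) (picks (x ∷ xs))

Q1 : List ℕ → ℕ → ℤ
Q1 λs t = Qfuel t (length λs) λs

oddParts : List ℕ → ℕ
oddParts []       = 0
oddParts (a ∷ as) = (if isEven a then 0 else 1) ℕ.+ oddParts as

evenParts : List ℕ → ℕ
evenParts []       = 0
evenParts (a ∷ as) = (if isEven a then 1 else 0) ℕ.+ evenParts as

minBars : List ℕ → ℕ
minBars λs = oddParts λs ⊔ (evenParts λs ℕ.+ (length λs % 2))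

evalPoly : List ℚ → ℚ → ℚ
evalPoly []       x = ℚ.0ℚ
evalPoly (c ∷ cs) x = c ℚ.+ x ℚ.* evalPoly cs x

ℤ→ℚ : ℤ → ℚ
ℤ→ℚ z = z ℚ./ 1

ℕ→ℚ : ℕ → ℚ
ℕ→ℚ n = (+ n) ℚ./ 1

-- Write q_k for q_k(1^t). The q_k satisfy (k + 2) q_{k+2} = 2t q_{k+1} + k q_k with q_0 = 1 and
-- q_1 = 2t, so t divides q_k for k ≥ 1 and t² divides q_k for even k ≥ 2. Hence, for a ≥ 1, every
-- product q_{a+m} q_{b-m} in Q_(a,b) is divisible by t² when a + b is even and by t otherwise: the
-- only factor not divisible by t is q_0 = 1, and it is paired with q_{a+b}. Expanding Q_λ by the
-- Pfaffian recursion gives terms ± q_y Q_μ (ℓ(λ) odd) or ± Q_(λ₁,y) Q_μ (ℓ(λ) even), with μ the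
-- partition left after removing those parts. Removing them lowers minBars by at most the power of
-- t gained from the removed factor, so induction on ℓ(λ) proves the theorem. Divisibility is meant in ℚ[t], as the recurrence divides by k + 2.

module Submission where

open import Defs
open import Data.Nat using (ℕ; _<_; _>_; _^_)
open import Data.Rational using (ℚ; _*_)
open import Data.List using (List)
open import Data.List.Relation.Unary.All using (All)
open import Data.List.Relation.Unary.Linked using (Linked)
open import Data.Product using (∃)
open import Relation.Binary.PropositionalEquality using (_≡_)

open import Data.Bool using (true; false; not; if_then_else_)
open import Data.Bool.Properties using (not-involutive; not-injective)
open import Data.Integer as ℤ using (ℤ; +_)
import Data.Integer.Properties as ℤ
open import Data.List using ([]; _∷_; length)
import Data.List.Relation.Binary.Permutation.Propositional as ↭
open ↭ using (_↭_; ↭-refl; ↭-prep; ↭-swap; ↭-trans; ↭-sym)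
open import Data.List.Relation.Binary.Permutation.Propositional.Properties using (↭-length; All-resp-↭)
open import Data.Nat as ℕ using (zero; suc; _≤_; _∸_)
open import Data.Nat.DivMod using (_%_)
import Data.Nat.Properties as ℕ
open import Data.Nat.Tactic.RingSolver using (solve-∀) renaming (solve to solveℕ)
open import Data.Product using (_×_; _,_; proj₁; proj₂)
open import Data.Rational using (_+_; 0ℚ; 1ℚ; 1/_)
open import Data.Rational.Literals using (fromℤ)
import Data.Rational.Properties as ℚ
open import Data.Rational.Solver using (module +-*-Solver)
open import Algebra.Properties.CommutativeSemigroup ℕ.+-commutativeSemigroup using (x∙yz≈y∙xz)
open import Relation.Binary.PropositionalEquality
  using (refl; sym; trans; cong; cong₂; subst; module ≡-Reasoning)

open +-*-Solver using (solve; _:=_; _:+_; _:*_; con)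

-- The helpers `go` of altSum and pairSum and `mapRest` of picks are local to `where` blocks of
-- Defs and cannot be referred to. Each `= _` below is solved by unification from the equation
-- after it, in which with-abstraction turns the helper's arguments into variables. The helper of
-- pairSum starts its index j at the offset m, so it is only captured after one unrolled step.

mutual
  altSumFrom : {A : Set} → (A → ℤ) → ℕ → List A → ℤ
  altSumFrom = _

  altSum≡altSumFrom : {A : Set} (f : A → ℤ) (xs : List A) → altSum f xs ≡ altSumFrom f 0 xs
  altSum≡altSumFrom f xs with 0
  ... | i = refl

mutual
  prependToRests : {A : Set} → A → List A → List (A × List A) → List (A × List A)
  prependToRests = _

  picks-∷ : {A : Set} (x : A) (xs : List A) →
    picks (x ∷ xs) ≡ (x , xs) ∷ prependToRests x xs (picks xs)
  picks-∷ x xs with picks xs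
  ... | r = refl

mutual
  pairSumFrom : ℕ → ℕ → ℕ → ℕ → ℕ → ℤ
  pairSumFrom = _

  pairSum-unfold : ∀ t a n → pairSum t a (suc (suc n)) 1
    ≡ sign 1 ℤ.* (q t (a ℕ.+ 1) ℤ.* q t (suc n)) ℤ.+ pairSumFrom t a (suc (suc n)) n 2
  pairSum-unfold t a n with 2 | suc (suc n)
  ... | j | b = refl

-- Polynomial functions divisible by a power of t

ℤ→ℚ≡fromℤ : ∀ z → ℤ→ℚ z ≡ fromℤ z
ℤ→ℚ≡fromℤ z = ℚ.↥p/↧p≡p (fromℤ z)

ℤ→ℚ-+ : ∀ a b → ℤ→ℚ (a ℤ.+ b) ≡ ℤ→ℚ a + ℤ→ℚ b
ℤ→ℚ-+ a b rewrite ℤ→ℚ≡fromℤ a | ℤ→ℚ≡fromℤ b =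
  cong ℤ→ℚ (sym (cong₂ ℤ._+_ (ℤ.*-identityʳ a) (ℤ.*-identityʳ b)))

ℤ→ℚ-* : ∀ a b → ℤ→ℚ (a ℤ.* b) ≡ ℤ→ℚ a * ℤ→ℚ b
ℤ→ℚ-* a b rewrite ℤ→ℚ≡fromℤ a | ℤ→ℚ≡fromℤ b = refl

ℕ→ℚ-* : ∀ m n → ℕ→ℚ (m ℕ.* n) ≡ ℕ→ℚ m * ℕ→ℚ n
ℕ→ℚ-* m n = trans (cong ℤ→ℚ (ℤ.pos-* m n)) (ℤ→ℚ-* (+ m) (+ n))

addPoly : List ℚ → List ℚ → List ℚ
addPoly []      Q       = Q
addPoly (a ∷ P) []      = a ∷ P
addPoly (a ∷ P) (b ∷ Q) = (a + b) ∷ addPoly P Q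

scalePoly : ℚ → List ℚ → List ℚ
scalePoly c []      = []
scalePoly c (a ∷ P) = c * a ∷ scalePoly c P

mulPoly : List ℚ → List ℚ → List ℚ
mulPoly []      Q = []
mulPoly (a ∷ P) Q = addPoly (scalePoly a Q) (0ℚ ∷ mulPoly P Q)

evalPoly-addPoly : ∀ P Q x → evalPoly (addPoly P Q) x ≡ evalPoly P x + evalPoly Q x
evalPoly-addPoly []      Q       x = sym (ℚ.+-identityˡ _)
evalPoly-addPoly (a ∷ P) []      x = sym (ℚ.+-identityʳ _)
evalPoly-addPoly (a ∷ P) (b ∷ Q) x rewrite evalPoly-addPoly P Q x =
  solve 5 (λ a b x u v → (a :+ b) :+ x :* (u :+ v) := (a :+ x :* u) :+ (b :+ x :* v))
    refl a b x (evalPoly P x) (evalPoly Q x)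

evalPoly-scalePoly : ∀ c P x → evalPoly (scalePoly c P) x ≡ c * evalPoly P x
evalPoly-scalePoly c []      x = sym (ℚ.*-zeroʳ c)
evalPoly-scalePoly c (a ∷ P) x rewrite evalPoly-scalePoly c P x =
  solve 4 (λ c a x u → c :* a :+ x :* (c :* u) := c :* (a :+ x :* u)) refl c a x (evalPoly P x)

evalPoly-mulPoly : ∀ P Q x → evalPoly (mulPoly P Q) x ≡ evalPoly P x * evalPoly Q x
evalPoly-mulPoly []      Q x = sym (ℚ.*-zeroˡ (evalPoly Q x))
evalPoly-mulPoly (a ∷ P) Q x
  rewrite evalPoly-addPoly (scalePoly a Q) (0ℚ ∷ mulPoly P Q) x
        | evalPoly-scalePoly a Q x
        | evalPoly-mulPoly P Q x =
  solve 4 (λ a x u v → a :* v :+ (con 0ℚ :+ x :* (u :* v)) := (a :+ x :* u) :* v)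
    refl a x (evalPoly P x) (evalPoly Q x)

infix 4 t^_∣_

record t^_∣_ (d : ℕ) (f : ℕ → ℤ) : Set where
  constructor divides
  field
    quotient : List ℚ
    equality : ∀ t → ℤ→ℚ (f t) ≡ ℕ→ℚ (t ^ d) * evalPoly quotient (ℕ→ℚ t)

private
  variable
    d e : ℕ
    f g : ℕ → ℤ

∣-resp : (∀ t → f t ≡ g t) → t^ d ∣ f → t^ d ∣ g
∣-resp f≡g (divides P eq) = divides P λ t → trans (cong ℤ→ℚ (sym (f≡g t))) (eq t)

∣-+ : t^ d ∣ f → t^ d ∣ g → t^ d ∣ (λ t → f t ℤ.+ g t)
∣-+ {d} {f} {g} (divides P eqP) (divides Q eqQ) = divides (addPoly P Q) λ t →
  let x = ℕ→ℚ t; c = ℕ→ℚ (t ^ d) in begin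
  ℤ→ℚ (f t ℤ.+ g t)                   ≡⟨ ℤ→ℚ-+ (f t) (g t) ⟩
  ℤ→ℚ (f t) + ℤ→ℚ (g t)               ≡⟨ cong₂ _+_ (eqP t) (eqQ t) ⟩
  c * evalPoly P x + c * evalPoly Q x ≡⟨ ℚ.*-distribˡ-+ c _ _ ⟨
  c * (evalPoly P x + evalPoly Q x)   ≡⟨ cong (c *_) (evalPoly-addPoly P Q x) ⟨
  c * evalPoly (addPoly P Q) x        ∎
  where open ≡-Reasoning

∣-* : t^ d ∣ f → t^ e ∣ g → t^ (d ℕ.+ e) ∣ (λ t → f t ℤ.* g t)
∣-* {d} {f} {e} {g} (divides P eqP) (divides Q eqQ) = divides (mulPoly P Q) λ t →
  let x = ℕ→ℚ t; c = ℕ→ℚ (t ^ d); c′ = ℕ→ℚ (t ^ e); u = evalPoly P x; v = evalPoly Q x in begin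
  ℤ→ℚ (f t ℤ.* g t)     ≡⟨ ℤ→ℚ-* (f t) (g t) ⟩
  ℤ→ℚ (f t) * ℤ→ℚ (g t) ≡⟨ cong₂ _*_ (eqP t) (eqQ t) ⟩
  (c * u) * (c′ * v)    ≡⟨ solve 4 (λ c u c′ v → (c :* u) :* (c′ :* v) := (c :* c′) :* (u :* v))
                             refl c u c′ v ⟩
  (c * c′) * (u * v)    ≡⟨ cong₂ _*_ (ℕ→ℚ-^-+ t) (evalPoly-mulPoly P Q x) ⟨
  ℕ→ℚ (t ^ (d ℕ.+ e)) * evalPoly (mulPoly P Q) x ∎
  where
  open ≡-Reasoning
  ℕ→ℚ-^-+ : ∀ t → ℕ→ℚ (t ^ (d ℕ.+ e)) ≡ ℕ→ℚ (t ^ d) * ℕ→ℚ (t ^ e)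
  ℕ→ℚ-^-+ t = trans (cong ℕ→ℚ (ℕ.^-distribˡ-+-* t d e)) (ℕ→ℚ-* (t ^ d) (t ^ e))

∣-const : ∀ c → t^ 0 ∣ (λ _ → c)
∣-const c = divides (ℤ→ℚ c ∷ []) λ t →
  solve 2 (λ c x → c := con 1ℚ :* (c :+ x :* con 0ℚ)) refl (ℤ→ℚ c) (ℕ→ℚ t)

∣-id : t^ 1 ∣ (λ t → + t)
∣-id = divides (1ℚ ∷ []) λ t → trans
  (solve 1 (λ x → x := x :* (con 1ℚ :+ x :* con 0ℚ)) refl (ℕ→ℚ t))
  (cong (λ n → ℕ→ℚ n * evalPoly (1ℚ ∷ []) (ℕ→ℚ t)) (sym (ℕ.*-identityʳ t)))

∣-zero : t^ d ∣ (λ _ → + 0)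
∣-zero {d} = divides [] λ t → sym (ℚ.*-zeroʳ (ℕ→ℚ (t ^ d)))

∣-weaken-suc : t^ suc d ∣ f → t^ d ∣ f
∣-weaken-suc {d} {f} (divides P eq) = divides (0ℚ ∷ P) λ t →
  let x = ℕ→ℚ t; c = ℕ→ℚ (t ^ d); u = evalPoly P x in begin
  ℤ→ℚ (f t)               ≡⟨ eq t ⟩
  ℕ→ℚ (t ℕ.* t ^ d) * u   ≡⟨ cong (_* u) (ℕ→ℚ-* t (t ^ d)) ⟩
  (x * c) * u             ≡⟨ solve 3 (λ x c u → (x :* c) :* u := c :* (con 0ℚ :+ x :* u)) refl x c u ⟩
  c * evalPoly (0ℚ ∷ P) x ∎
  where open ≡-Reasoning

∣-weaken : e ≤ d → t^ d ∣ f → t^ e ∣ f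
∣-weaken e≤d = go (ℕ.≤⇒≤′ e≤d)
  where
  go : ∀ {e d f} → e ℕ.≤′ d → t^ d ∣ f → t^ e ∣ f
  go ℕ.≤′-refl       h = h
  go (ℕ.≤′-step e≤d) h = go e≤d (∣-weaken-suc h)

∣-cancelˡ : ∀ c → t^ d ∣ (λ t → + suc c ℤ.* f t) → t^ d ∣ f
∣-cancelˡ {d} {f} c (divides P eq) = divides (scalePoly c⁻¹ P) λ t →
  let x = ℕ→ℚ t; T = ℕ→ℚ (t ^ d); u = evalPoly P x; y = ℤ→ℚ (f t) in begin
  y                                ≡⟨ ℚ.*-identityˡ y ⟨
  1ℚ * y                           ≡⟨ cong (_* y) (ℚ.*-inverseˡ C) ⟨
  (c⁻¹ * C) * y                    ≡⟨ ℚ.*-assoc c⁻¹ C y ⟩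
  c⁻¹ * (C * y)                    ≡⟨ cong (c⁻¹ *_) (C*f t) ⟨
  c⁻¹ * ℤ→ℚ (+ suc c ℤ.* f t)      ≡⟨ cong (c⁻¹ *_) (eq t) ⟩
  c⁻¹ * (T * u)                    ≡⟨ solve 3 (λ a T u → a :* (T :* u) := T :* (a :* u)) refl c⁻¹ T u ⟩
  T * (c⁻¹ * u)                    ≡⟨ cong (T *_) (evalPoly-scalePoly c⁻¹ P x) ⟨
  T * evalPoly (scalePoly c⁻¹ P) x ∎
  where
  open ≡-Reasoning
  C = fromℤ (+ suc c)
  c⁻¹ = 1/ C
  C*f : ∀ t → ℤ→ℚ (+ suc c ℤ.* f t) ≡ C * ℤ→ℚ (f t)
  C*f t = trans (ℤ→ℚ-* (+ suc c) (f t)) (cong (_* ℤ→ℚ (f t)) (ℤ→ℚ≡fromℤ (+ suc c)))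

-- The sequence q_k(1^t)

qnat-zero : ∀ t → qnat t 0 ≡ 1
qnat-zero zero    = refl
qnat-zero (suc t) = trans (ℕ.+-identityʳ (qnat t 0)) (qnat-zero t)

qnat-one : ∀ t → qnat t 1 ≡ 2 ℕ.* t
qnat-one zero    = refl
qnat-one (suc t) rewrite qnat-zero t | qnat-one t = solveℕ (t ∷ [])

qnat-two : ∀ t → qnat t 2 ≡ 2 ℕ.* (t ℕ.* t)
qnat-two zero    = refl
qnat-two (suc t) rewrite qnat-zero t | qnat-one t | qnat-two t = solveℕ (t ∷ [])

-- From (1 - u) ((1+u)/(1-u))^(t+1) = (1 + u) ((1+u)/(1-u))^t.
qnat-pascal : ∀ t k → qnat (suc t) (suc k) ≡ qnat (suc t) k ℕ.+ qnat t (suc k) ℕ.+ qnat t k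
qnat-pascal t k = identity (qnat t (suc k)) (sumBelow (qnat t) k) (qnat t k)
  where
  identity : ∀ a s b → a ℕ.+ 2 ℕ.* (s ℕ.+ b) ≡ (b ℕ.+ 2 ℕ.* s) ℕ.+ a ℕ.+ b
  identity = solve-∀

-- The coefficient form of (1 - u²) F′ = 2t F for F = ((1+u)/(1-u))^t.
recurrenceˡ : (ℕ → ℕ) → ℕ → ℕ
recurrenceˡ x k = suc (suc k) ℕ.* x (suc (suc k))

recurrenceʳ : ℕ → (ℕ → ℕ) → ℕ → ℕ
recurrenceʳ t x k = 2 ℕ.* (t ℕ.* x (suc k)) ℕ.+ k ℕ.* x k

Recurrence : ℕ → (ℕ → ℕ) → ℕ → Set
Recurrence t x k = recurrenceˡ x k ≡ recurrenceʳ t x k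

-- The defect of the recurrence obeys the same Pascal rule as the sequences; `balance` states this
-- with all subtractions moved to the other side, where it is a semiring identity.
recurrence-step : ∀ {t k} (a b : ℕ → ℕ) → (∀ j → a (suc j) ≡ a j ℕ.+ b (suc j) ℕ.+ b j) →
  Recurrence (suc t) a k → Recurrence t b (suc k) → Recurrence t b k → Recurrence (suc t) a (suc k)
recurrence-step {t} {k} a b pascal recₐ rec₁ rec₀ =
  ℕ.+-cancelʳ-≡ (recurrenceʳ (suc t) a k ℕ.+ recurrenceʳ t b (suc k) ℕ.+ recurrenceʳ t b k) _ _
    (trans (balance (a k) (a (suc k)) (a (suc (suc k))) (a (suc (suc (suc k))))
                    (b k) (b (suc k)) (b (suc (suc k))) (b (suc (suc (suc k))))
                    (pascal k) (pascal (suc k)) (pascal (suc (suc k))))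
           (cong (recurrenceʳ (suc t) a (suc k) ℕ.+_) (cong₂ ℕ._+_ (cong₂ ℕ._+_ recₐ rec₁) rec₀)))
  where
  balance : ∀ a₀ a₁ a₂ a₃ b₀ b₁ b₂ b₃ →
    a₁ ≡ a₀ ℕ.+ b₁ ℕ.+ b₀ → a₂ ≡ a₁ ℕ.+ b₂ ℕ.+ b₁ → a₃ ≡ a₂ ℕ.+ b₃ ℕ.+ b₂ →
    suc (suc (suc k)) ℕ.* a₃
      ℕ.+ ((2 ℕ.* (suc t ℕ.* a₁) ℕ.+ k ℕ.* a₀)
      ℕ.+ (2 ℕ.* (t ℕ.* b₂) ℕ.+ suc k ℕ.* b₁)
      ℕ.+ (2 ℕ.* (t ℕ.* b₁) ℕ.+ k ℕ.* b₀))
    ≡ (2 ℕ.* (suc t ℕ.* a₂) ℕ.+ suc k ℕ.* a₁)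
      ℕ.+ (suc (suc k) ℕ.* a₂ ℕ.+ suc (suc (suc k)) ℕ.* b₃ ℕ.+ suc (suc k) ℕ.* b₂)
  balance a₀ _ _ _ b₀ b₁ b₂ b₃ refl refl refl = solveℕ (t ∷ k ∷ a₀ ∷ b₀ ∷ b₁ ∷ b₂ ∷ b₃ ∷ [])

qnat-recurrence : ∀ t k → Recurrence t (qnat t) k
qnat-recurrence t       zero    rewrite qnat-one t | qnat-two t = solveℕ (t ∷ [])
qnat-recurrence zero    (suc k) = solveℕ (k ∷ [])
qnat-recurrence (suc t) (suc k) = recurrence-step {t} {k} (qnat (suc t)) (qnat t) (qnat-pascal t)
  (qnat-recurrence (suc t) k) (qnat-recurrence t (suc k)) (qnat-recurrence t k)

q-recurrence : ∀ t k →
  + suc (suc k) ℤ.* q t (suc (suc k)) ≡ + 2 ℤ.* (+ t ℤ.* q t (suc k)) ℤ.+ + k ℤ.* q t k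
q-recurrence t k = begin
  + suc (suc k) ℤ.* q t (suc (suc k))    ≡⟨ ℤ.pos-* (suc (suc k)) (qnat t (suc (suc k))) ⟨
  + recurrenceˡ (qnat t) k               ≡⟨ cong +_ (qnat-recurrence t k) ⟩
  + recurrenceʳ t (qnat t) k             ≡⟨ ℤ.pos-+ (2 ℕ.* (t ℕ.* qnat t (suc k))) (k ℕ.* qnat t k) ⟩
  + (2 ℕ.* (t ℕ.* qnat t (suc k))) ℤ.+ + (k ℕ.* qnat t k)
    ≡⟨ cong₂ ℤ._+_
         (trans (ℤ.pos-* 2 (t ℕ.* qnat t (suc k))) (cong (+ 2 ℤ.*_) (ℤ.pos-* t (qnat t (suc k)))))
         (ℤ.pos-* k (qnat t k)) ⟩
  + 2 ℤ.* (+ t ℤ.* q t (suc k)) ℤ.+ + k ℤ.* q t k ∎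
  where open ≡-Reasoning

-- The order of vanishing of q_k(1^t) at t = 0 for k ≥ 1; it is minBars of the partition (k).
qOrder : ℕ → ℕ
qOrder k = if isEven k then 2 else 1

qOrder≤2 : ∀ k → qOrder k ≤ 2
qOrder≤2 k with isEven k
... | true  = ℕ.≤-refl
... | false = ℕ.s≤s ℕ.z≤n

1≤qOrder : ∀ k → 1 ≤ qOrder k
1≤qOrder k with isEven k
... | true  = ℕ.s≤s ℕ.z≤n
... | false = ℕ.≤-refl

qOrder-suc-suc : ∀ k → qOrder (suc (suc k)) ≡ qOrder k
qOrder-suc-suc k = cong (λ b → if b then 2 else 1) (not-involutive (isEven k))

q-∣ : ∀ k → t^ qOrder (suc k) ∣ (λ t → q t (suc k))
q-∣ zero          = ∣-resp (λ t → sym (q-one t)) (∣-* (∣-const (+ 2)) ∣-id)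
  where
  q-one : ∀ t → q t 1 ≡ + 2 ℤ.* + t
  q-one t = trans (cong +_ (qnat-one t)) (ℤ.pos-* 2 t)
q-∣ (suc zero)    = ∣-resp (λ t → sym (q-two t)) (∣-* (∣-const (+ 2)) (∣-* ∣-id ∣-id))
  where
  q-two : ∀ t → q t 2 ≡ + 2 ℤ.* (+ t ℤ.* + t)
  q-two t = trans (cong +_ (qnat-two t))
                  (trans (ℤ.pos-* 2 (t ℕ.* t)) (cong (+ 2 ℤ.*_) (ℤ.pos-* t t)))
q-∣ (suc (suc k)) = ∣-cancelˡ (suc (suc k)) (∣-resp (λ t → sym (q-recurrence t (suc k)))
  (∣-+ (∣-weaken (ℕ.≤-trans (qOrder≤2 (3 ℕ.+ k)) (ℕ.s≤s (1≤qOrder (2 ℕ.+ k))))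
          (∣-* (∣-const (+ 2)) (∣-* ∣-id (q-∣ (suc k)))))
       (∣-weaken (ℕ.≤-reflexive (qOrder-suc-suc (suc k)))
          (∣-* (∣-const (+ suc k)) (q-∣ k)))))

-- Two-part Q-functions

q*q-∣ : ∀ i n → t^ qOrder (suc i ℕ.+ n) ∣ (λ t → q t (suc i) ℤ.* q t n)
q*q-∣ i zero =
  subst (λ m → t^ qOrder m ∣ (λ t → q t (suc i) ℤ.* q t 0)) (sym (ℕ.+-identityʳ (suc i)))
    (∣-resp (λ t → trans (sym (ℤ.*-identityʳ (q t (suc i))))
                         (cong (λ c → q t (suc i) ℤ.* + c) (sym (qnat-zero t))))
      (q-∣ i))
q*q-∣ i (suc n) =
  ∣-weaken (ℕ.≤-trans (qOrder≤2 (suc i ℕ.+ suc n)) (ℕ.+-mono-≤ (1≤qOrder (suc i)) (1≤qOrder (suc n))))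
    (∣-* (q-∣ i) (q-∣ n))

pairTerm-∣ : ∀ a b j → j ≤ b →
  t^ qOrder (suc a ℕ.+ b) ∣ (λ t → sign j ℤ.* (q t (suc a ℕ.+ j) ℤ.* q t (b ∸ j)))
pairTerm-∣ a b j j≤b = ∣-* (∣-const (sign j))
  (subst (λ m → t^ qOrder m ∣ (λ t → q t (suc a ℕ.+ j) ℤ.* q t (b ∸ j)))
    (cong suc (trans (ℕ.+-assoc a j (b ∸ j)) (cong (a ℕ.+_) (ℕ.m+[n∸m]≡n j≤b))))
    (q*q-∣ (a ℕ.+ j) (b ∸ j)))

pairSumFrom-∣ : ∀ a b n j → j ℕ.+ n ≡ b →
  t^ qOrder (suc a ℕ.+ b) ∣ (λ t → pairSumFrom t (suc a) b n j)
pairSumFrom-∣ a b zero    j j+n≡b = pairTerm-∣ a b j (subst (j ≤_) j+n≡b (ℕ.m≤m+n j 0))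
pairSumFrom-∣ a b (suc n) j j+n≡b = ∣-+
  (pairTerm-∣ a b j (subst (j ≤_) j+n≡b (ℕ.m≤m+n j (suc n))))
  (pairSumFrom-∣ a b n (suc j) (trans (sym (ℕ.+-suc j n)) j+n≡b))

Qpair-∣ : ∀ a b → t^ qOrder (suc a ℕ.+ b) ∣ (λ t → Qpair t (suc a) b)
Qpair-∣ a zero          = q*q-∣ a zero
Qpair-∣ a (suc zero)    = ∣-+ (q*q-∣ a 1) (∣-* (∣-const (+ 2)) (pairTerm-∣ a 1 1 ℕ.≤-refl))
Qpair-∣ a (suc (suc n)) = ∣-+ (q*q-∣ a (suc (suc n))) (∣-* (∣-const (+ 2))
  (∣-resp (λ t → sym (pairSum-unfold t (suc a) n))
    (∣-+ (pairTerm-∣ a (suc (suc n)) 1 (ℕ.s≤s ℕ.z≤n)) (pairSumFrom-∣ a (suc (suc n)) n 2 refl))))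

-- Removing parts from a partition

isEven-+ : ∀ m n → isEven (m ℕ.+ n) ≡ (if isEven m then isEven n else not (isEven n))
isEven-+ zero    n = refl
isEven-+ (suc m) n rewrite isEven-+ m n with isEven m
... | true  = refl
... | false = not-involutive (isEven n)

even⇒%2≡0 : ∀ n → isEven n ≡ true → n % 2 ≡ 0
even⇒%2≡0 zero          _    = refl
even⇒%2≡0 (suc (suc n)) even = even⇒%2≡0 n (trans (sym (not-involutive (isEven n))) even)

even⇒suc%2≡1 : ∀ n → isEven n ≡ true → suc n % 2 ≡ 1
even⇒suc%2≡1 zero          _    = refl
even⇒suc%2≡1 (suc (suc n)) even = even⇒suc%2≡1 n (trans (sym (not-involutive (isEven n))) even)

⊔-≤-+ : ∀ {a b c d} k → a ≤ k ℕ.+ c → b ≤ k ℕ.+ d → a ℕ.⊔ b ≤ k ℕ.+ (c ℕ.⊔ d)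
⊔-≤-+ {c = c} {d} k a≤ b≤ = ℕ.⊔-lub
  (ℕ.≤-trans a≤ (ℕ.+-monoʳ-≤ k (ℕ.m≤m⊔n c d)))
  (ℕ.≤-trans b≤ (ℕ.+-monoʳ-≤ k (ℕ.m≤n⊔m c d)))

minBars-∷-≤ : ∀ y ys → isEven (length ys) ≡ true → minBars (y ∷ ys) ≤ qOrder y ℕ.+ minBars ys
minBars-∷-≤ y ys even
  rewrite even⇒suc%2≡1 (length ys) even | even⇒%2≡0 (length ys) even
        | ℕ.+-comm (evenParts (y ∷ ys)) 1 | ℕ.+-identityʳ (evenParts ys) =
  bound (isEven y) (oddParts ys) (evenParts ys)
  where
  bound : ∀ b o e → ((if b then 0 else 1) ℕ.+ o) ℕ.⊔ suc ((if b then 1 else 0) ℕ.+ e)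
                      ≤ (if b then 2 else 1) ℕ.+ (o ℕ.⊔ e)
  bound true  o e = ⊔-≤-+ {c = o} {e} 2 (ℕ.m≤n+m o 2) ℕ.≤-refl
  bound false o e = ⊔-≤-+ {c = o} {e} 1 ℕ.≤-refl ℕ.≤-refl

minBars-∷∷-≤ : ∀ x y ys → isEven (length ys) ≡ true →
  minBars (x ∷ y ∷ ys) ≤ qOrder (x ℕ.+ y) ℕ.+ minBars ys
minBars-∷∷-≤ x y ys even
  rewrite isEven-+ x y | even⇒%2≡0 (length ys) even
        | ℕ.+-identityʳ (evenParts (x ∷ y ∷ ys)) | ℕ.+-identityʳ (evenParts ys) =
  bound (isEven x) (isEven y) (oddParts ys) (evenParts ys)
  where
  bound : ∀ b c o e →
    ((if b then 0 else 1) ℕ.+ ((if c then 0 else 1) ℕ.+ o))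
      ℕ.⊔ ((if b then 1 else 0) ℕ.+ ((if c then 1 else 0) ℕ.+ e))
    ≤ (if (if b then c else not c) then 2 else 1) ℕ.+ (o ℕ.⊔ e)
  bound true  true  o e = ⊔-≤-+ {c = o} {e} 2 (ℕ.m≤n+m o 2) ℕ.≤-refl
  bound true  false o e = ⊔-≤-+ {c = o} {e} 1 ℕ.≤-refl ℕ.≤-refl
  bound false true  o e = ⊔-≤-+ {c = o} {e} 1 ℕ.≤-refl ℕ.≤-refl
  bound false false o e = ⊔-≤-+ {c = o} {e} 2 ℕ.≤-refl (ℕ.m≤n+m e 2)

additive-↭ : {A : Set} (h : List A → ℕ) (w : A → ℕ) → (∀ a as → h (a ∷ as) ≡ w a ℕ.+ h as) →
  ∀ {xs ys} → xs ↭ ys → h xs ≡ h ys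
additive-↭ {A} h w h-∷ = go
  where
  open ≡-Reasoning
  go : ∀ {xs ys : List A} → xs ↭ ys → h xs ≡ h ys
  go ↭.refl                   = refl
  go (↭.prep a p)             = trans (h-∷ a _) (trans (cong (w a ℕ.+_) (go p)) (sym (h-∷ a _)))
  go (↭.swap {xs} {ys} a b p) = begin
    h (a ∷ b ∷ xs)         ≡⟨ trans (h-∷ a _) (cong (w a ℕ.+_) (h-∷ b xs)) ⟩
    w a ℕ.+ (w b ℕ.+ h xs) ≡⟨ cong (λ z → w a ℕ.+ (w b ℕ.+ z)) (go p) ⟩
    w a ℕ.+ (w b ℕ.+ h ys) ≡⟨ x∙yz≈y∙xz (w a) (w b) (h ys) ⟩
    w b ℕ.+ (w a ℕ.+ h ys) ≡⟨ trans (h-∷ b _) (cong (w b ℕ.+_) (h-∷ a ys)) ⟨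
    h (b ∷ a ∷ ys)         ∎
  go (↭.trans p p′)           = trans (go p) (go p′)

minBars-↭ : ∀ {xs ys} → xs ↭ ys → minBars xs ≡ minBars ys
minBars-↭ p = cong₂ ℕ._⊔_
  (additive-↭ oddParts (λ a → if isEven a then 0 else 1) (λ _ _ → refl) p)
  (cong₂ (λ e n → e ℕ.+ n % 2)
    (additive-↭ evenParts (λ a → if isEven a then 1 else 0) (λ _ _ → refl) p)
    (↭-length p))

-- The Pfaffian expansion

-- Opened only here: overloading [] and _∷_ earlier makes the variable lists given to solveℕ
-- ambiguous.
open import Data.List.Relation.Unary.All using ([]; _∷_; map; tail)

picks-↭ : {A : Set} (xs : List A) → All (λ p → proj₁ p ∷ proj₂ p ↭ xs) (picks xs)
picks-↭ []       = []
picks-↭ (x ∷ xs) = subst (All _) (sym (picks-∷ x xs)) (↭-refl ∷ prepend-↭ (picks-↭ xs))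
  where
  prepend-↭ : ∀ {r} → All (λ p → proj₁ p ∷ proj₂ p ↭ xs) r →
    All (λ p → proj₁ p ∷ proj₂ p ↭ x ∷ xs) (prependToRests x xs r)
  prepend-↭ []                      = []
  prepend-↭ {(y , ys) ∷ _} (h ∷ hs) = ↭-trans (↭-swap y x ↭-refl) (↭-prep x h) ∷ prepend-↭ hs

altSumFrom-∣ : {A : Set} {F : ℕ → A → ℤ} → ∀ i xs →
  All (λ x → t^ d ∣ (λ t → F t x)) xs → t^ d ∣ (λ t → altSumFrom (F t) i xs)
altSumFrom-∣ i []       []       = ∣-zero
altSumFrom-∣ i (x ∷ xs) (h ∷ hs) = ∣-+ (∣-* (∣-const (sign i)) h) (altSumFrom-∣ (suc i) xs hs)

altSum-∣ : {A : Set} {F : ℕ → A → ℤ} → ∀ xs →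
  All (λ x → t^ d ∣ (λ t → F t x)) xs → t^ d ∣ (λ t → altSum (F t) xs)
altSum-∣ {F = F} xs hs = ∣-resp (λ t → sym (altSum≡altSumFrom (F t) xs)) (altSumFrom-∣ 0 xs hs)

Qfuel-∣ : ∀ n xs → length xs ≤ n → All (0 <_) xs → t^ minBars xs ∣ (λ t → Qfuel t n xs)
Qfuel-∣ zero    []           _             _        = ∣-const (+ 1)
Qfuel-∣ (suc n) []           _             _        = ∣-const (+ 1)
Qfuel-∣ (suc n) (zero ∷ xs)  _             (() ∷ _)
Qfuel-∣ (suc n) (suc a ∷ xs) (ℕ.s≤s len≤n) pos with isEven (length xs) in parity
... | true  = altSum-∣ (picks (suc a ∷ xs)) (map pickedPart (picks-↭ (suc a ∷ xs)))
  where
  pickedPart : ∀ {p} → proj₁ p ∷ proj₂ p ↭ suc a ∷ xs →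
    t^ minBars (suc a ∷ xs) ∣ (λ t → q t (proj₁ p) ℤ.* Qfuel t n (proj₂ p))
  pickedPart {y , ys} perm with All-resp-↭ (↭-sym perm) pos
  ... | ℕ.s≤s _ ∷ pos-ys =
    ∣-weaken bound (∣-* (q-∣ _) (Qfuel-∣ n ys (subst (_≤ n) (sym |ys|≡|xs|) len≤n) pos-ys))
    where
    |ys|≡|xs| : length ys ≡ length xs
    |ys|≡|xs| = ℕ.suc-injective (↭-length perm)
    bound : minBars (suc a ∷ xs) ≤ qOrder y ℕ.+ minBars ys
    bound = ℕ.≤-trans (ℕ.≤-reflexive (minBars-↭ (↭-sym perm)))
                      (minBars-∷-≤ y ys (trans (cong isEven |ys|≡|xs|) parity))
... | false = altSum-∣ (picks xs) (map pairedPart (picks-↭ xs))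
  where
  pairedPart : ∀ {p} → proj₁ p ∷ proj₂ p ↭ xs →
    t^ minBars (suc a ∷ xs) ∣ (λ t → Qpair t (suc a) (proj₁ p) ℤ.* Qfuel t n (proj₂ p))
  pairedPart {y , ys} perm = ∣-weaken bound
    (∣-* (Qpair-∣ a y) (Qfuel-∣ n ys |ys|≤n (tail (All-resp-↭ (↭-sym perm) (tail pos)))))
    where
    |ys|≤n : length ys ≤ n
    |ys|≤n = ℕ.<⇒≤ (subst (_≤ n) (sym (↭-length perm)) len≤n)
    bound : minBars (suc a ∷ xs) ≤ qOrder (suc a ℕ.+ y) ℕ.+ minBars ys
    bound = ℕ.≤-trans (ℕ.≤-reflexive (minBars-↭ (↭-prep (suc a) (↭-sym perm))))
      (minBars-∷∷-≤ (suc a) y ys (not-injective (trans (cong isEven (↭-length perm)) parity)))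

mainTheorem6 : (λs : List ℕ) → Linked _>_ λs → All (λ a → 0 < a) λs →
    ∃ λ (P : List ℚ) → (t : ℕ) →
      ℤ→ℚ (Q1 λs t) ≡ ℕ→ℚ (t ^ minBars λs) * evalPoly P (ℕ→ℚ t)
mainTheorem6 λs _ positive = quotient , equality
  where open t^_∣_ (Qfuel-∣ (length λs) λs ℕ.≤-refl positive)
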